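{- There exist an infinite family $\mathcal F$ of connected graphs and a constant $c>0$ such that, for every $G=(V,E)\in\mathcal F$, with $p=|V|$ robots and edge budget $\beta=\Theta(\sqrt{|V|})$, the graph cannot be made universally solvable for $p$ robots by adding at most $\beta$ new edges together with at most $\alpha$ new vertices whenever $\alpha<c\sqrt{|V|}$; that is, universal solvability requires a vertex budget $\alpha=\Omega(\sqrt{|V|})$.
   Context: Augmentation: one may add new vertices and new edges, each new edge joining two original vertices, an original and a new vertex, or two new vertices. Robots are $R=[p]$; a configuration on a graph $H=(W,F)$ is an injective map $S:R\to W$. A pair $(S,S')$ of configurations is a valid move if it is one of: (i) a simple path move: there is a simple path $(u_0,\dots,u_k)$ in $H$ with $u_k\notin S(R)$, $u_0\notin S'(R)$, $S'(i)=S(i)$ for robots not on the path, and $S'(i)=u_{j+1}$ whenever $S(i)=u_j$, $0\le j\le k-1$; (ii) a simple rotation move: there is a simple cycle $(u_0,\dots,u_{k-1},u_k=u_0)$ in $H$ all of whose vertices are occupied in $S$ and in $S'$, robots off the cycle stay fixed, and $S'(i)=u_{j+1}$ whenever $S(i)=u_j$; (iii) a dummy move $(S,S)$. $T$ is reachable from $S$ if there is a finite sequence $S=S_0,\dots,S_t=T$ with each $(S_{k-1},S_k)$ a valid move. $H$ is universally solvable for $p$ robots if every configuration is reachable from every other. -}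

module Defs where

open import Data.Nat using (ℕ; zero; suc; _+_; _*_; _≤_; _<_)
open import Data.Bool using (Bool; true; false; _∧_; not; if_then_else_)
open import Data.Fin using (Fin; zero; suc; inject₁; fromℕ; _↑ˡ_; splitAt; toℕ)
open import Data.Fin.Properties using (_<?_)
open import Data.Sum using (_⊎_; inj₁; inj₂)
open import Data.Product using (Σ; ∃; _×_; _,_)
open import Relation.Binary.PropositionalEquality using (_≡_; _≢_)
open import Relation.Nullary.Decidable using (⌊_⌋)
open import Relation.Binary.Construct.Closure.ReflexiveTransitive using (Star)
open import Function.Definitions using (Injective)

record Graph (n : ℕ) : Set where
  field
    adj    : Fin n → Fin n → Bool
    sym    : ∀ u v → adj u v ≡ adj v u
    irrefl : ∀ u → adj u u ≡ false
open Graph public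

Adj : ∀ {n} → Graph n → Fin n → Fin n → Set
Adj G u v = adj G u v ≡ true

Connected : ∀ {n} → Graph n → Set
Connected G = ∀ u v → Star (Adj G) u v

count : ∀ {n} → (Fin n → Bool) → ℕ
count {zero}  f = 0
count {suc n} f = (if f zero then 1 else 0) + count (λ i → f (suc i))

oldEdge : ∀ {n a} → Graph n → Fin (n + a) → Fin (n + a) → Bool
oldEdge {n} G u v with splitAt n u | splitAt n v
... | inj₁ u' | inj₁ v' = adj G u' v'
... | _       | _       = false

sumFin : ∀ {n} → (Fin n → ℕ) → ℕ
sumFin {zero}  f = 0
sumFin {suc n} f = f zero + sumFin (λ i → f (suc i))

newEdgeCount : ∀ {n a} → Graph n → Graph (n + a) → ℕ
newEdgeCount G H =
  sumFin (λ u → count (λ v → ⌊ u <? v ⌋ ∧ adj H u v ∧ not (oldEdge G u v)))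

-- H is an augmentation of G by exactly a new vertices (vertices n, ..., n+a-1)
-- and at most b new edges: H contains G on the original vertices.
IsAugmentation : ∀ {n} → Graph n → (a b : ℕ) → Graph (n + a) → Set
IsAugmentation {n} G a b H =
  (∀ u v → Adj G u v → Adj H (u ↑ˡ a) (v ↑ˡ a)) × (newEdgeCount G H ≤ b)

record Config (p m : ℕ) : Set where
  field
    pos : Fin p → Fin m
    inj : Injective _≡_ _≡_ pos
open Config public

SimplePathMove : ∀ {p m} → Graph m → Config p m → Config p m → Set
SimplePathMove {p} {m} H S S' =
  Σ ℕ λ k → Σ (Fin (suc k) → Fin m) λ u →
    Injective _≡_ _≡_ u
    × (∀ (j : Fin k) → Adj H (u (inject₁ j)) (u (suc j)))
    × (∀ i → pos S i ≢ u (fromℕ k))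
    × (∀ i → pos S' i ≢ u zero)
    × (∀ i → (∀ j → pos S i ≢ u j) → pos S' i ≡ pos S i)
    × (∀ i (j : Fin k) → pos S i ≡ u (inject₁ j) → pos S' i ≡ u (suc j))

-- simple rotation move along a simple cycle (u₀,…,u_{k-1},u₀), k ≥ 3,
-- written as u : Fin (suc (suc (suc l))) → Fin m (so k = l + 3)
SimpleRotationMove : ∀ {p m} → Graph m → Config p m → Config p m → Set
SimpleRotationMove {p} {m} H S S' =
  Σ ℕ λ l → Σ (Fin (suc (suc (suc l))) → Fin m) λ u →
    Injective _≡_ _≡_ u
    × (∀ (j : Fin (suc (suc l))) → Adj H (u (inject₁ j)) (u (suc j)))
    × Adj H (u (fromℕ (suc (suc l)))) (u zero)
    × (∀ j → ∃ λ i → pos S i ≡ u j)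
    × (∀ j → ∃ λ i → pos S' i ≡ u j)
    × (∀ i → (∀ j → pos S i ≢ u j) → pos S' i ≡ pos S i)
    × (∀ i (j : Fin (suc (suc l))) → pos S i ≡ u (inject₁ j) → pos S' i ≡ u (suc j))
    × (∀ i → pos S i ≡ u (fromℕ (suc (suc l))) → pos S' i ≡ u zero)

DummyMove : ∀ {p m} → Config p m → Config p m → Set
DummyMove S S' = ∀ i → pos S' i ≡ pos S i

ValidMove : ∀ {p m} → Graph m → Config p m → Config p m → Set
ValidMove H S S' = SimplePathMove H S S' ⊎ SimpleRotationMove H S S' ⊎ DummyMove S S'

Reachable : ∀ {p m} → Graph m → Config p m → Config p m → Set
Reachable H = Star (ValidMove H)

UniversallySolvable : ∀ {m} → Graph m → (p : ℕ) → Set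
UniversallySolvable H p = ∀ (S T : Config p _) → Reachable H S T

-- The graphs are spiders.  At most β new edges touch at most 2β vertices, so a spider with
-- more than 2β legs keeps a leg none of whose vertices gains an edge: in the augmented graph
-- it is still a dead-end path ending in a leaf.  With |V| robots on |V| + a vertices there are
-- only a holes.  A robot r starting at the leaf stays trapped: r remains on the leg with every
-- leg vertex between r and the leaf vacant.  Filling the leg up to its last vertex would take
-- more holes than exist, so r only ever steps along the leg; nobody else can enter the vacant
-- part, and r cannot step outwards while its outer neighbour steps in, because no valid move
-- exchanges two robots along an edge.  Hence r never reaches the centre.
module Submission where

open import Defs
open import Data.Nat using (ℕ; _+_; _*_; _≤_; _<_; NonZero)
open import Data.Product using (Σ; ∃; _×_)
open import Relation.Nullary using (¬_)

open import Data.Bool using (Bool; true; false; _∧_; not; if_then_else_)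
open import Data.Empty using (⊥; ⊥-elim)
open import Data.Fin using (Fin; zero; suc; toℕ; inject₁; fromℕ; _↑ˡ_; _↑ʳ_; splitAt; join; combine; remQuot)
open import Data.Fin.Induction using (>-weakInduction)
open import Data.Fin.Permutation as Perm using (Permutation; _⟨$⟩ʳ_; _⟨$⟩ˡ_; transpose)
open import Data.Fin.Properties as Fin
  using (toℕ-injective; toℕ<n; toℕ-inject₁; toℕ-fromℕ; inject₁ℕ<; inject₁-injective; ↑ˡ-injective;
         splitAt-↑ˡ; splitAt⁻¹-↑ˡ; join-splitAt; combine-injective; combine-remQuot; remQuot-combine;
         <-cmp; _<?_; any?; <⇒notInjective)
  renaming (_≟_ to _≟ᶠ_)
open import Data.Fin.Relation.Unary.Top using (View; view; ‵fromℕ; ‵inject₁; view-fromℕ; view-inject₁)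
open import Data.Nat using (zero; suc; z≤n; s≤s; s≤s⁻¹)
open import Data.Nat.Properties
  using (+-0-commutativeMonoid; +-assoc; +-suc; +-mono-≤; +-monoʳ-<; *-mono-≤; *-monoʳ-≤; m≤m+n; m≤n+m;
         ≤-refl; ≤-reflexive; ≤-trans; <-trans; ≤-<-trans; <-irrefl; <⇒≤; <⇒≱; ≮⇒≥; ≤∧≢⇒<; n≤0⇒n≡0;
         m≤n⇒m<n∨m≡n; m≢1+n+m; 1+n≢n; module ≤-Reasoning)
open import Algebra.Properties.CommutativeMonoid.Sum +-0-commutativeMonoid
  using (sum; sum-syntax; ∑-comm; ∑-distrib-+; sum-cong-≗)
open import Data.Nat.Tactic.RingSolver using (solve-∀)
open import Data.Product using (_,_; proj₁; proj₂; uncurry)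
open import Data.Sum using (_⊎_; inj₁; inj₂; [_,_]′; swap)
open import Data.Vec.Functional using (_++_)
open import Function using (_∘_; mk⇔)
open import Function.Definitions using (Injective)
open import Level using (0ℓ)
open import Relation.Binary using (Rel; Decidable; Symmetric; tri<; tri≈; tri>)
open import Relation.Binary.Construct.Closure.ReflexiveTransitive using (Star; ε; _◅_; _◅◅_; reverse)
open import Relation.Binary.PropositionalEquality as ≡ hiding (sym)
open import Relation.Nullary using (yes; no; ¬?; does)
open import Relation.Nullary.Decidable using (⌊_⌋; dec-true; dec-false; does-⇔; _×-dec_; _⊎-dec_)

indicator : Bool → ℕ
indicator b = if b then 1 else 0

sumFin≡sum : ∀ {n} (f : Fin n → ℕ) → sumFin f ≡ sum f
sumFin≡sum {zero}  f = refl
sumFin≡sum {suc n} f = cong (f zero +_) (sumFin≡sum (f ∘ suc))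

count≡sum : ∀ {n} (f : Fin n → Bool) → count f ≡ ∑[ i < n ] indicator (f i)
count≡sum {zero}  f = refl
count≡sum {suc n} f = cong (indicator (f zero) +_) (count≡sum (f ∘ suc))

sum-mono-≤ : ∀ {n} {f g : Fin n → ℕ} → (∀ i → f i ≤ g i) → sum f ≤ sum g
sum-mono-≤ {zero}  f≤g = z≤n
sum-mono-≤ {suc n} f≤g = +-mono-≤ (f≤g zero) (sum-mono-≤ (f≤g ∘ suc))

term≤sum : ∀ {n} (f : Fin n → ℕ) i → f i ≤ sum f
term≤sum f zero    = m≤m+n _ _
term≤sum f (suc i) = ≤-trans (term≤sum (f ∘ suc) i) (m≤n+m _ _)

sum-++ : ∀ m {n} (f : Fin (m + n) → ℕ) → sum f ≡ ∑[ i < m ] f (i ↑ˡ n) + ∑[ j < n ] f (m ↑ʳ j)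
sum-++ zero    f = refl
sum-++ (suc m) f = trans (cong (f zero +_) (sum-++ m (f ∘ suc))) (≡.sym (+-assoc (f zero) _ _))

sum-↑ˡ≤ : ∀ m {n} (f : Fin (m + n) → ℕ) → ∑[ i < m ] f (i ↑ˡ n) ≤ sum f
sum-↑ˡ≤ m f = ≤-trans (m≤m+n _ _) (≤-reflexive (≡.sym (sum-++ m f)))

sum-combine : ∀ m n (f : Fin (m * n) → ℕ) → sum f ≡ ∑[ i < m ] ∑[ j < n ] f (combine i j)
sum-combine zero    n f = refl
sum-combine (suc m) n f = trans (sum-++ n f) (cong (∑[ j < n ] f (j ↑ˡ (m * n)) +_) (sum-combine m n (f ∘ (n ↑ʳ_))))

sum<n⇒zero : ∀ {n} (f : Fin n → ℕ) → sum f < n → ∃ λ i → f i ≡ 0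
sum<n⇒zero {suc n} f s<n with f zero in f₀
... | zero  = zero , f₀
... | suc z =
  let i , fi≡0 = sum<n⇒zero (f ∘ suc) (≤-trans (s≤s (m≤n+m _ z)) (s≤s⁻¹ s<n)) in suc i , fi≡0

count≡0⇒false : ∀ {n} (f : Fin n → Bool) → count f ≡ 0 → ∀ i → f i ≡ false
count≡0⇒false f count≡0 i with f i | term≤sum (indicator ∘ f) i
... | false | _     = refl
... | true  | 1≤sum with () ← ≤-trans 1≤sum (≤-reflexive (trans (≡.sym (count≡sum f)) count≡0))

Adj-sym : ∀ {n} (G : Graph n) {u v} → Adj G u v → Adj G v u
Adj-sym G {u} {v} uv = trans (Graph.sym G v u) uv

oldEdge-sym : ∀ {n a} (G : Graph n) (u v : Fin (n + a)) → oldEdge {a = a} G u v ≡ oldEdge G v u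
oldEdge-sym {n} G u v with splitAt n u | splitAt n v
... | inj₁ u' | inj₁ v' = Graph.sym G u' v'
... | inj₁ _  | inj₂ _  = refl
... | inj₂ _  | inj₁ _  = refl
... | inj₂ _  | inj₂ _  = refl

oldEdge-↑ˡ : ∀ {n a} (G : Graph n) (w : Fin n) (y : Fin (n + a)) → oldEdge G (w ↑ˡ a) y ≡ true →
             ∃ λ z → y ≡ z ↑ˡ a × Adj G w z
oldEdge-↑ˡ {n} {a} G w y old with splitAt n (w ↑ˡ a) in split-w | splitAt n y in split-y
... | inj₁ w' | inj₁ y' with refl ← trans (≡.sym (splitAt-↑ˡ n w a)) split-w = y' , ≡.sym (splitAt⁻¹-↑ˡ split-y) , old

module _ {n a} (G : Graph n) (H : Graph (n + a)) where

  newEdge : Fin (n + a) → Fin (n + a) → Bool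
  newEdge u v = adj H u v ∧ not (oldEdge G u v)

  newDegree : Fin (n + a) → ℕ
  newDegree u = count (newEdge u)

  newEdge-sym : ∀ u v → newEdge u v ≡ newEdge v u
  newEdge-sym u v = cong₂ (λ b c → b ∧ not c) (Graph.sym H u v) (oldEdge-sym G u v)

  private
    forward backward : Fin (n + a) → Fin (n + a) → ℕ
    forward  u v = indicator (⌊ u <? v ⌋ ∧ newEdge u v)
    backward u v = indicator (⌊ v <? u ⌋ ∧ newEdge u v)

    newEdge-oriented : ∀ u v → indicator (newEdge u v) ≤ forward u v + backward u v
    newEdge-oriented u v with newEdge u v in uv | u <? v | v <? u
    ... | false | _     | _     = z≤n
    ... | true  | yes _ | _     = s≤s z≤n
    ... | true  | no _  | yes _ = s≤s z≤n
    ... | true  | no u≮v | no v≮u with <-cmp u v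
    ...   | tri< u<v _ _ = ⊥-elim (u≮v u<v)
    ...   | tri> _ _ v<u = ⊥-elim (v≮u v<u)
    ...   | tri≈ _ refl _ with () ← trans (≡.sym uv) (cong (_∧ _) (Graph.irrefl H u))

    backward≡forward : ∀ u v → backward u v ≡ forward v u
    backward≡forward u v = cong (λ b → indicator (⌊ v <? u ⌋ ∧ b)) (newEdge-sym u v)

    ∑forward≡newEdgeCount : ∑[ u < n + a ] ∑[ v < n + a ] forward u v ≡ newEdgeCount G H
    ∑forward≡newEdgeCount =
      ≡.sym (trans (sumFin≡sum (λ u → count (λ v → ⌊ u <? v ⌋ ∧ newEdge u v)))
                   (sum-cong-≗ (λ u → count≡sum (λ v → ⌊ u <? v ⌋ ∧ newEdge u v))))

  ∑newDegree≤2·newEdgeCount : ∑[ u < n + a ] newDegree u ≤ newEdgeCount G H + newEdgeCount G H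
  ∑newDegree≤2·newEdgeCount = begin
    ∑[ u < n + a ] newDegree u
      ≡⟨ sum-cong-≗ (λ u → count≡sum (newEdge u)) ⟩
    ∑[ u < n + a ] ∑[ v < n + a ] indicator (newEdge u v)
      ≤⟨ sum-mono-≤ (λ u → sum-mono-≤ (newEdge-oriented u)) ⟩
    ∑[ u < n + a ] ∑[ v < n + a ] (forward u v + backward u v)
      ≡⟨ sum-cong-≗ (λ u → ∑-distrib-+ (forward u) (backward u)) ⟩
    ∑[ u < n + a ] (∑[ v < n + a ] forward u v + ∑[ v < n + a ] backward u v)
      ≡⟨ ∑-distrib-+ (λ u → ∑[ v < n + a ] forward u v) (λ u → ∑[ v < n + a ] backward u v) ⟩
    ∑[ u < n + a ] ∑[ v < n + a ] forward u v + ∑[ u < n + a ] ∑[ v < n + a ] backward u v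
      ≡⟨ cong (∑[ u < n + a ] ∑[ v < n + a ] forward u v +_) (∑-comm backward) ⟩
    ∑[ u < n + a ] ∑[ v < n + a ] forward u v + ∑[ v < n + a ] ∑[ u < n + a ] backward u v
      ≡⟨ cong (∑[ u < n + a ] ∑[ v < n + a ] forward u v +_) (sum-cong-≗ λ v → sum-cong-≗ λ u → backward≡forward u v) ⟩
    ∑[ u < n + a ] ∑[ v < n + a ] forward u v + ∑[ v < n + a ] ∑[ u < n + a ] forward v u
      ≡⟨ cong₂ _+_ ∑forward≡newEdgeCount ∑forward≡newEdgeCount ⟩
    newEdgeCount G H + newEdgeCount G H ∎
    where open ≤-Reasoning

  newDegree≡0⇒oldNeighbours : ∀ w {y} → newDegree (w ↑ˡ a) ≡ 0 → Adj H (w ↑ˡ a) y →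
                              ∃ λ z → y ≡ z ↑ˡ a × Adj G w z
  newDegree≡0⇒oldNeighbours w {y} isolated wy =
    oldEdge-↑ˡ G w y (old wy (count≡0⇒false (newEdge (w ↑ˡ a)) isolated y))
    where
    old : ∀ {b c} → b ≡ true → b ∧ not c ≡ false → c ≡ true
    old {true} {true} _ _ = refl

-- Asymmetry of Step is all that the argument needs of simple paths and cycles: no two
-- robots exchange places along an edge.
record LocalMove {p M} (H : Graph M) (S S' : Config p M) : Set₁ where
  field
    Step         : Fin M → Fin M → Set
    step⇒adj     : ∀ {v w} → Step v w → Adj H v w
    step-asym    : ∀ {v w} → Step v w → ¬ Step w v
    stay-or-step : ∀ q → pos S' q ≡ pos S q ⊎ Step (pos S q) (pos S' q)

PathStep : ∀ {M k} → (Fin (suc k) → Fin M) → Fin M → Fin M → Set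
PathStep u v w = ∃ λ j → v ≡ u (inject₁ j) × w ≡ u (suc j)

CycleStep : ∀ {M l} → (Fin (3 + l) → Fin M) → Fin M → Fin M → Set
CycleStep u v w = PathStep u v w ⊎ (v ≡ u (fromℕ _) × w ≡ u zero)

inject₁≡suc⇒suc≢inject₁ : ∀ {k} (j j' : Fin k) → inject₁ j ≡ suc j' → suc j ≢ inject₁ j'
inject₁≡suc⇒suc≢inject₁ j j' j≡1+j' 1+j≡j' = m≢1+n+m (toℕ j') (begin
  toℕ j'                   ≡⟨ toℕ-inject₁ j' ⟨
  toℕ (inject₁ j')         ≡⟨ cong toℕ 1+j≡j' ⟨
  suc (toℕ j)              ≡⟨ cong suc (toℕ-inject₁ j) ⟨
  suc (toℕ (inject₁ j))    ≡⟨ cong (suc ∘ toℕ) j≡1+j' ⟩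
  suc (suc (toℕ j'))       ∎)
  where open ≡-Reasoning

inject₁≡0⇒suc≢last : ∀ {l} (j : Fin (2 + l)) → inject₁ j ≡ zero → suc j ≢ fromℕ (2 + l)
inject₁≡0⇒suc≢last zero refl ()

pathStep-asym : ∀ {M k} {u : Fin (suc k) → Fin M} → Injective _≡_ _≡_ u →
                ∀ {v w} → PathStep u v w → ¬ PathStep u w v
pathStep-asym u-inj (j , refl , refl) (j' , at-1+j , at-j) =
  inject₁≡suc⇒suc≢inject₁ j j' (u-inj at-j) (u-inj at-1+j)

cycleStep-asym : ∀ {M l} {u : Fin (3 + l) → Fin M} → Injective _≡_ _≡_ u →
                 ∀ {v w} → CycleStep u v w → ¬ CycleStep u w v
cycleStep-asym u-inj (inj₁ vw) (inj₁ wv) = pathStep-asym u-inj vw wv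
cycleStep-asym u-inj (inj₁ (j , refl , refl)) (inj₂ (at-1+j , at-j)) =
  inject₁≡0⇒suc≢last j (u-inj at-j) (u-inj at-1+j)
cycleStep-asym u-inj (inj₂ (refl , refl)) (inj₁ (j , 0≡j , last≡1+j)) =
  inject₁≡0⇒suc≢last j (≡.sym (u-inj 0≡j)) (≡.sym (u-inj last≡1+j))
cycleStep-asym u-inj (inj₂ (refl , refl)) (inj₂ (0≡last , _)) with () ← u-inj 0≡last

module _ {p M} {H : Graph M} {S S' : Config p M} where

  pathMove-local : SimplePathMove H S S' → LocalMove H S S'
  pathMove-local (k , u , u-inj , edges , end-vacant , _ , fixed , forward) = record
    { Step         = PathStep u
    ; step⇒adj     = λ { (j , refl , refl) → edges j }
    ; step-asym    = pathStep-asym u-inj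
    ; stay-or-step = move
    }
    where
    move : ∀ q → pos S' q ≡ pos S q ⊎ PathStep u (pos S q) (pos S' q)
    move q with any? (λ t → pos S q ≟ᶠ u t)
    ... | no off = inj₁ (fixed q (λ t on → off (t , on)))
    ... | yes (t , on) with view t
    ...   | ‵fromℕ     = ⊥-elim (end-vacant q on)
    ...   | ‵inject₁ j = inj₂ (j , on , forward q j on)

  rotationMove-local : SimpleRotationMove H S S' → LocalMove H S S'
  rotationMove-local (l , u , u-inj , edges , closing , _ , _ , fixed , forward , wrap) = record
    { Step         = CycleStep u
    ; step⇒adj     = λ { (inj₁ (j , refl , refl)) → edges j ; (inj₂ (refl , refl)) → closing }
    ; step-asym    = cycleStep-asym u-inj
    ; stay-or-step = move
    }
    where
    move : ∀ q → pos S' q ≡ pos S q ⊎ CycleStep u (pos S q) (pos S' q)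
    move q with any? (λ t → pos S q ≟ᶠ u t)
    ... | no off = inj₁ (fixed q (λ t on → off (t , on)))
    ... | yes (t , on) with view t
    ...   | ‵fromℕ     = inj₂ (inj₂ (on , wrap q on))
    ...   | ‵inject₁ j = inj₂ (inj₁ (j , on , forward q j on))

  dummyMove-local : DummyMove S S' → LocalMove H S S'
  dummyMove-local stay = record
    { Step = λ _ _ → ⊥ ; step⇒adj = λ () ; step-asym = λ () ; stay-or-step = inj₁ ∘ stay }

  validMove-local : ValidMove H S S' → LocalMove H S S'
  validMove-local (inj₁ path)            = pathMove-local path
  validMove-local (inj₂ (inj₁ rotation)) = rotationMove-local rotation
  validMove-local (inj₂ (inj₂ dummy))    = dummyMove-local dummy

++-injective : ∀ {A : Set} {m n} {xs : Fin m → A} {ys : Fin n → A} →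
               Injective _≡_ _≡_ xs → Injective _≡_ _≡_ ys → (∀ i j → xs i ≢ ys j) →
               Injective _≡_ _≡_ (xs ++ ys)
++-injective {m = m} {n} {xs} {ys} xs-inj ys-inj disjoint {i} {j} eq = begin
  i                      ≡⟨ join-splitAt m n i ⟨
  join m n (splitAt m i) ≡⟨ cong (join m n) (split-injective (splitAt m i) (splitAt m j) eq) ⟩
  join m n (splitAt m j) ≡⟨ join-splitAt m n j ⟩
  j                      ∎
  where
  open ≡-Reasoning
  split-injective : ∀ s t → [ xs , ys ]′ s ≡ [ xs , ys ]′ t → s ≡ t
  split-injective (inj₁ s) (inj₁ t) eq = cong inj₁ (xs-inj eq)
  split-injective (inj₁ s) (inj₂ t) eq = ⊥-elim (disjoint s t eq)
  split-injective (inj₂ s) (inj₁ t) eq = ⊥-elim (disjoint t s (≡.sym eq))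
  split-injective (inj₂ s) (inj₂ t) eq = cong inj₂ (ys-inj eq)

Consecutive : ∀ {n} → Fin n → Fin n → Set
Consecutive i i' = toℕ i' ≡ suc (toℕ i) ⊎ toℕ i ≡ suc (toℕ i')

module DeadEnd {p M K} (H : Graph M) (x : Fin (suc K) → Fin M) (x-inj : Injective _≡_ _≡_ x)
  (dead-end : ∀ i {y} → toℕ i < K → Adj H (x i) y → ∃ λ i' → y ≡ x i' × Consecutive i i')
  (few-holes : M < p + K) (r : Fin p) where

  Vacant : Config p M → Fin M → Set
  Vacant S v = ∀ q → pos S q ≢ v

  record Trapped (S : Config p M) : Set where
    constructor trapped
    field
      front         : Fin (suc K)
      at-front      : pos S r ≡ x front
      behind-vacant : ∀ i → toℕ i < toℕ front → Vacant S (x i)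

  not-all-vacant : ∀ S → ¬ (∀ (c : Fin K) → Vacant S (x (inject₁ c)))
  not-all-vacant S vacant = <⇒notInjective few-holes
    (++-injective (inj S) (λ e → inject₁-injective (x-inj e)) (λ q c → vacant c q))

  module _ {S : Config p M} (t : Trapped S) where
    open Trapped t

    -- otherwise x 0, …, x (K - 1) would be K holes, but there are fewer than K
    front<K : toℕ front < K
    front<K = ≤∧≢⇒< (s≤s⁻¹ (toℕ<n front)) λ front≡K →
      not-all-vacant S λ c → behind-vacant (inject₁ c) (subst (toℕ (inject₁ c) <_) (≡.sym front≡K) (inject₁ℕ< c))

    occupied-neighbour : ∀ i q → toℕ i ≤ toℕ front → Adj H (x i) (pos S q) →
                         ∃ λ i' → pos S q ≡ x i' × toℕ i' ≡ suc (toℕ i)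
    occupied-neighbour i q i≤front adjacent with dead-end i (≤-<-trans i≤front front<K) adjacent
    ... | i' , at-i' , inj₁ outward = i' , at-i' , outward
    ... | i' , at-i' , inj₂ inward  = ⊥-elim (behind-vacant i' (≤-trans (≤-reflexive (≡.sym inward)) i≤front) q at-i')

    occupied-neighbour-of-vacant : ∀ i q → toℕ i < toℕ front → Adj H (x i) (pos S q) →
                                   q ≡ r × toℕ front ≡ suc (toℕ i)
    occupied-neighbour-of-vacant i q i<front adjacent with occupied-neighbour i q (<⇒≤ i<front) adjacent
    ... | i' , at-i' , outward with m≤n⇒m<n∨m≡n (subst (_≤ toℕ front) (≡.sym outward) i<front)
    ...   | inj₁ i'<front = ⊥-elim (behind-vacant i' i'<front q at-i')
    ...   | inj₂ i'≡front =
      inj S (trans at-i' (trans (cong x (toℕ-injective i'≡front)) (≡.sym at-front))) ,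
      trans (≡.sym i'≡front) outward

  module _ {S S' : Config p M} (move : LocalMove H S S') (t : Trapped S) where
    open LocalMove move
    open Trapped t

    arrival : ∀ i q → toℕ i < toℕ front → pos S' q ≡ x i → q ≡ r × toℕ front ≡ suc (toℕ i)
    arrival i q i<front at-i with stay-or-step q
    ... | inj₁ stay = ⊥-elim (behind-vacant i i<front q (trans (≡.sym stay) at-i))
    ... | inj₂ step = occupied-neighbour-of-vacant t i q i<front
                        (Adj-sym H (subst (Adj H (pos S q)) at-i (step⇒adj step)))

    vacant-unless-r : ∀ {j} → pos S' r ≡ x j → (∀ i q → toℕ i < toℕ j → pos S' q ≡ x i → q ≡ r) →
                      ∀ i → toℕ i < toℕ j → Vacant S' (x i)
    vacant-unless-r r-at-j only-r i i<j q at-i with refl ← only-r i q i<j at-i =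
      Fin.<⇒≢ i<j (x-inj (trans (≡.sym at-i) r-at-j))

    -- a robot entering x front can only come from x j, swapping places with r
    no-swap-at-front : ∀ {j} → toℕ j ≡ suc (toℕ front) → pos S' r ≡ x j →
                       ∀ q → pos S' q ≡ x front → q ≡ r
    no-swap-at-front {j} outward r-at-j q at-front' with stay-or-step q | stay-or-step r
    ... | inj₁ stay | _ = inj S (trans (≡.sym stay) (trans at-front' (≡.sym at-front)))
    ... | inj₂ q-step | inj₁ r-stay with () ← Fin.<⇒≢ (≤-reflexive (≡.sym outward))
          (x-inj (trans (≡.sym at-front) (trans (≡.sym r-stay) r-at-j)))
    ... | inj₂ q-step | inj₂ r-step
      with i' , at-i' , i'≡1+front ← occupied-neighbour t front q ≤-refl
             (Adj-sym H (subst (Adj H (pos S q)) at-front' (step⇒adj q-step)))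
      with refl ← toℕ-injective (trans i'≡1+front (≡.sym outward)) =
      ⊥-elim (step-asym (subst₂ Step at-front r-at-j r-step) (subst₂ Step at-i' at-front' q-step))

    trapped-step : Trapped S'
    trapped-step with stay-or-step r
    ... | inj₁ stay = trapped front r-at-front (vacant-unless-r r-at-front λ i q i<front → proj₁ ∘ arrival i q i<front)
      where r-at-front = trans stay at-front
    ... | inj₂ step with dead-end front (front<K t) (subst (λ v → Adj H v (pos S' r)) at-front (step⇒adj step))
    ...   | j , r-at-j , inj₂ inward = trapped j r-at-j (vacant-unless-r r-at-j λ i q i<j →
            proj₁ ∘ arrival i q (<-trans i<j (≤-reflexive (≡.sym inward))))
    ...   | j , r-at-j , inj₁ outward = trapped j r-at-j (vacant-unless-r r-at-j only-r)
      where
      only-r : ∀ i q → toℕ i < toℕ j → pos S' q ≡ x i → q ≡ r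
      only-r i q i<j at-i with m≤n⇒m<n∨m≡n (s≤s⁻¹ (subst (suc (toℕ i) ≤_) outward i<j))
      ... | inj₁ i<front = proj₁ (arrival i q i<front at-i)
      ... | inj₂ i≡front = no-swap-at-front outward r-at-j q (subst (λ i → pos S' q ≡ x i) (toℕ-injective i≡front) at-i)

  reachable-trapped : ∀ {S T} → Reachable H S T → Trapped S → Trapped T
  reachable-trapped ε            t = t
  reachable-trapped (move ◅ rest) t = reachable-trapped rest (trapped-step (validMove-local move) t)

module _ {n} {R : Rel (Fin n) 0ℓ} (R? : Decidable R) (R-sym : Symmetric R) (R-irrefl : ∀ u → ¬ R u u) where

  graphOf : Graph n
  graphOf = record
    { adj    = λ u v → does (R? u v)
    ; sym    = λ u v → does-⇔ (mk⇔ R-sym R-sym) (R? u v) (R? v u)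
    ; irrefl = λ u → dec-false (R? u u) (R-irrefl u)
    }

  Adj-graphOf⁻ : ∀ {u v} → Adj graphOf u v → R u v
  Adj-graphOf⁻ {u} {v} uv with R? u v
  ... | yes r = r

  Adj-graphOf : ∀ {u v} → R u v → Adj graphOf u v
  Adj-graphOf {u} {v} = dec-true (R? u v)

-- m legs of suc L' vertices; leg ℓ zero is a tip and leg ℓ (fromℕ L') is joined to the
-- centre.  The parent of a vertex is its neighbour towards the centre (the centre is its own).
module Spider (m L' : ℕ) where

  N : ℕ
  N = suc (m * suc L')

  centre : Fin N
  centre = zero

  leg : Fin m → Fin (suc L') → Fin N
  leg ℓ i = suc (combine ℓ i)

  data SpiderVertex : Fin N → Set where
    is-centre : SpiderVertex centre
    is-leg    : ∀ ℓ i → SpiderVertex (leg ℓ i)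

  spiderVertex : ∀ v → SpiderVertex v
  spiderVertex zero = is-centre
  spiderVertex (suc w) = subst (SpiderVertex ∘ suc) (combine-remQuot {m} (suc L') w)
    (is-leg (proj₁ (remQuot {m} (suc L') w)) (proj₂ (remQuot {m} (suc L') w)))

  inwardFrom : Fin m → {i : Fin (suc L')} → View i → Fin N
  inwardFrom ℓ ‵fromℕ       = centre
  inwardFrom ℓ (‵inject₁ j) = leg ℓ (suc j)

  inward : Fin m → Fin (suc L') → Fin N
  inward ℓ i = inwardFrom ℓ (view i)

  parent : Fin N → Fin N
  parent zero    = centre
  parent (suc w) = uncurry inward (remQuot {m} (suc L') w)

  parent-leg : ∀ ℓ i → parent (leg ℓ i) ≡ inward ℓ i
  parent-leg ℓ i = cong (uncurry inward) (remQuot-combine ℓ i)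

  TreeEdge : Rel (Fin N) 0ℓ
  TreeEdge u v = u ≢ v × (parent u ≡ v ⊎ parent v ≡ u)

  treeEdge? : Decidable TreeEdge
  treeEdge? u v = ¬? (u ≟ᶠ v) ×-dec (parent u ≟ᶠ v ⊎-dec parent v ≟ᶠ u)

  treeEdge-sym : Symmetric TreeEdge
  treeEdge-sym (u≢v , e) = u≢v ∘ ≡.sym , swap e

  treeEdge-irrefl : ∀ u → ¬ TreeEdge u u
  treeEdge-irrefl u (u≢u , _) = u≢u refl

  spider : Graph N
  spider = graphOf treeEdge? treeEdge-sym treeEdge-irrefl

  treeEdge⇒Adj : ∀ {u v} → TreeEdge u v → Adj spider u v
  treeEdge⇒Adj = Adj-graphOf treeEdge? treeEdge-sym treeEdge-irrefl

  Adj⇒treeEdge : ∀ {u v} → Adj spider u v → TreeEdge u v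
  Adj⇒treeEdge = Adj-graphOf⁻ treeEdge? treeEdge-sym treeEdge-irrefl

  leg-injective : ∀ {ℓ ℓ' i i'} → leg ℓ i ≡ leg ℓ' i' → ℓ ≡ ℓ' × i ≡ i'
  leg-injective e = combine-injective _ _ _ _ (Fin.suc-injective e)

  inward-edge : ∀ ℓ j → Adj spider (leg ℓ (inject₁ j)) (leg ℓ (suc j))
  inward-edge ℓ j = treeEdge⇒Adj
    ( inject₁≢suc ∘ proj₂ ∘ leg-injective
    , inj₁ (trans (parent-leg ℓ (inject₁ j)) (cong (inwardFrom ℓ) (view-inject₁ j))) )
    where
    inject₁≢suc : inject₁ j ≢ suc j
    inject₁≢suc e = 1+n≢n (≡.sym (trans (≡.sym (toℕ-inject₁ j)) (cong toℕ e)))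

  hub-edge : ∀ ℓ → Adj spider (leg ℓ (fromℕ L')) centre
  hub-edge ℓ = treeEdge⇒Adj
    ((λ ()) , inj₁ (trans (parent-leg ℓ (fromℕ L')) (cong (inwardFrom ℓ) (view-fromℕ L'))))

  to-centre : ∀ v → Star (Adj spider) v centre
  to-centre v with spiderVertex v
  ... | is-centre  = ε
  ... | is-leg ℓ i = >-weakInduction (λ i → Star (Adj spider) (leg ℓ i) centre)
                       (hub-edge ℓ ◅ ε) (λ j rest → inward-edge ℓ j ◅ rest) i

  spider-connected : Connected spider
  spider-connected u v = to-centre u ◅◅ reverse (λ {u} {v} → Adj-sym spider {u} {v}) (to-centre v)

  inwardFrom-cases : ∀ {ℓ} {i : Fin (suc L')} (v : View i) →
                     (i ≡ fromℕ L' × inwardFrom ℓ v ≡ centre) ⊎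
                     ∃ λ i' → inwardFrom ℓ v ≡ leg ℓ i' × toℕ i' ≡ suc (toℕ i)
  inwardFrom-cases ‵fromℕ       = inj₁ (refl , refl)
  inwardFrom-cases (‵inject₁ j) = inj₂ (suc j , refl , cong suc (≡.sym (toℕ-inject₁ j)))

  inwardFrom-leg : ∀ {ℓ ℓ' i} {i' : Fin (suc L')} (v : View i') → inwardFrom ℓ' v ≡ leg ℓ i →
                   ℓ' ≡ ℓ × toℕ i ≡ suc (toℕ i')
  inwardFrom-leg (‵inject₁ j) e with refl , refl ← leg-injective e = refl , cong suc (≡.sym (toℕ-inject₁ j))

  child-of-leg : ∀ {ℓ i z} → SpiderVertex z → parent z ≡ leg ℓ i → ∃ λ i' → z ≡ leg ℓ i' × toℕ i ≡ suc (toℕ i')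
  child-of-leg (is-leg ℓ' i') e with refl , i≡1+i' ← inwardFrom-leg (view i') (trans (≡.sym (parent-leg ℓ' i')) e) =
    i' , refl , i≡1+i'

  leg-neighbour : ∀ {ℓ i z} → Adj spider (leg ℓ i) z →
                  (i ≡ fromℕ L' × z ≡ centre) ⊎ ∃ λ i' → z ≡ leg ℓ i' × Consecutive i i'
  leg-neighbour {ℓ} {i} {z} adjacent with proj₂ (Adj⇒treeEdge adjacent)
  ... | inj₂ child = let i' , z≡ , i≡1+i' = child-of-leg (spiderVertex z) child in inj₂ (i' , z≡ , inj₂ i≡1+i')
  ... | inj₁ parent≡z with inwardFrom-cases {ℓ} (view i) | trans (≡.sym (parent-leg ℓ i)) parent≡z
  ...   | inj₁ (last , hub)         | inward≡z = inj₁ (last , trans (≡.sym inward≡z) hub)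
  ...   | inj₂ (i' , out , i'≡1+i) | inward≡z = inj₂ (i' , trans (≡.sym inward≡z) out , inj₁ i'≡1+i)

placement : ∀ {p} a → Permutation p p → Config p (p + a)
placement a π = record
  { pos = λ q → (π ⟨$⟩ʳ q) ↑ˡ a
  ; inj = λ e → trans (≡.sym (Perm.inverseˡ π)) (trans (cong (π ⟨$⟩ˡ_) (↑ˡ-injective a _ _ e)) (Perm.inverseˡ π))
  }

transpose-here : ∀ {n} (i j : Fin n) → transpose i j ⟨$⟩ʳ i ≡ j
transpose-here i j rewrite dec-true (i ≟ᶠ i) refl = refl

module _ {m L' a : ℕ} (H : Graph (Spider.N m L' + a)) where
  open Spider m L'

  untouched-leg : ∀ {β} → newEdgeCount spider H ≤ β → β + β < m →
                  ∃ λ ℓ → ∀ i → newDegree spider H (leg ℓ i ↑ˡ a) ≡ 0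
  untouched-leg {β} few-new 2β<m =
    let ℓ , legSum≡0 = sum<n⇒zero legSum ∑legSum<m in
    ℓ , λ i → n≤0⇒n≡0 (≤-trans (term≤sum (λ i → degree (leg ℓ i)) i) (≤-reflexive legSum≡0))
    where
    open ≤-Reasoning
    degree : Fin N → ℕ
    degree v = newDegree spider H (v ↑ˡ a)
    legSum : Fin m → ℕ
    legSum ℓ = ∑[ i < suc L' ] degree (leg ℓ i)
    ∑legSum<m : sum legSum < m
    ∑legSum<m = begin-strict
      sum legSum                                   ≡⟨ sum-combine m (suc L') (degree ∘ suc) ⟨
      ∑[ w < m * suc L' ] degree (suc w)           ≤⟨ m≤n+m _ _ ⟩
      ∑[ v < N ] degree v                          ≤⟨ sum-↑ˡ≤ N (newDegree spider H) ⟩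
      ∑[ v < N + a ] newDegree spider H v          ≤⟨ ∑newDegree≤2·newEdgeCount spider H ⟩
      newEdgeCount spider H + newEdgeCount spider H ≤⟨ +-mono-≤ few-new few-new ⟩
      β + β                                        <⟨ 2β<m ⟩
      m                                            ∎

  untouched-leg-unsolvable : a < L' → ∀ ℓ → (∀ i → newDegree spider H (leg ℓ i ↑ˡ a) ≡ 0) →
                             ¬ UniversallySolvable H N
  untouched-leg-unsolvable a<L' ℓ untouched solvable =
    r-not-at-centre (reachable-trapped (solvable (placement a Perm.id) swapped) (trapped zero refl λ _ ()))
    where
    x : Fin (suc L') → Fin (N + a)
    x i = leg ℓ i ↑ˡ a
    dead-end : ∀ i {y} → toℕ i < L' → Adj H (x i) y → ∃ λ i' → y ≡ x i' × Consecutive i i'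
    dead-end i i<L' adjacent with newDegree≡0⇒oldNeighbours spider H (leg ℓ i) (untouched i) adjacent
    ... | z , refl , old with leg-neighbour old
    ...   | inj₁ (refl , _) = ⊥-elim (<-irrefl (toℕ-fromℕ L') i<L')
    ...   | inj₂ (i' , refl , consecutive) = i' , refl , consecutive
    r = leg ℓ zero
    open DeadEnd H x (λ e → proj₂ (leg-injective (↑ˡ-injective a _ _ e))) dead-end
                 (+-monoʳ-< N a<L') r
    swapped : Config N (N + a)
    swapped = placement a (transpose r centre)
    r-not-at-centre : ¬ Trapped swapped
    r-not-at-centre (trapped j centre≡leg _)
      with () ← ↑ˡ-injective a _ _ (trans (cong (_↑ˡ a) (≡.sym (transpose-here r centre))) centre≡leg)

  augmented-spider-unsolvable : ∀ {β} → a < L' → β + β < m → IsAugmentation spider a β H → ¬ UniversallySolvable H N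
  augmented-spider-unsolvable a<L' 2β<m (_ , few-new) =
    let ℓ , untouched = untouched-leg few-new 2β<m in untouched-leg-unsolvable a<L' ℓ untouched

-- 2k + 3 legs of k + 3 vertices and k + 1 new edges: the new edges miss a leg, and
-- 4α² < |V| = 2k² + 9k + 10 forces α ≤ k + 1, fewer holes than it takes to leave a leg.
legs : ℕ → ℕ
legs k = 3 + (k + k)

size : ℕ → ℕ
size k = Spider.N (legs k) (2 + k)

family : (k : ℕ) → Graph (size k)
family k = Spider.spider (legs k) (2 + k)

budget : ℕ → ℕ
budget k = suc k

m+d≡n⇒m≤n : ∀ {m n} d → m + d ≡ n → m ≤ n
m+d≡n⇒m≤n {m} d refl = m≤m+n m d

k≤size : ∀ k → k ≤ size k
k≤size k = m+d≡n⇒m≤n (2 * k * k + 8 * k + 10) (solve k)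
  where solve : ∀ k → k + (2 * k * k + 8 * k + 10) ≡ suc ((3 + (k + k)) * (3 + k))
        solve = solve-∀

budget²≤size : ∀ k → 1 * 1 * (budget k * budget k) ≤ 1 * 1 * size k
budget²≤size k = m+d≡n⇒m≤n (k * k + 7 * k + 9) (solve k)
  where solve : ∀ k → 1 * 1 * (suc k * suc k) + (k * k + 7 * k + 9) ≡ 1 * 1 * suc ((3 + (k + k)) * (3 + k))
        solve = solve-∀

size≤16·budget² : ∀ k → 1 * 1 * size k ≤ 4 * 4 * (budget k * budget k)
size≤16·budget² k = m+d≡n⇒m≤n (14 * k * k + 23 * k + 6) (solve k)
  where solve : ∀ k → 1 * 1 * suc ((3 + (k + k)) * (3 + k)) + (14 * k * k + 23 * k + 6) ≡ 4 * 4 * (suc k * suc k)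
        solve = solve-∀

size≤4·[2+k]² : ∀ k → 1 * 1 * size k ≤ 2 * 2 * ((2 + k) * (2 + k))
size≤4·[2+k]² k = m+d≡n⇒m≤n (2 * k * k + 7 * k + 6) (solve k)
  where solve : ∀ k → 1 * 1 * suc ((3 + (k + k)) * (3 + k)) + (2 * k * k + 7 * k + 6) ≡ 2 * 2 * ((2 + k) * (2 + k))
        solve = solve-∀

2·budget<legs : ∀ k → budget k + budget k < legs k
2·budget<legs k = s≤s (s≤s (≤-reflexive (+-suc k k)))

4α²<size⇒α≤1+k : ∀ k α → 2 * 2 * (α * α) < 1 * 1 * size k → α ≤ suc k
4α²<size⇒α≤1+k k α 4α²<size = ≮⇒≥ λ 2+k≤α →
  <⇒≱ 4α²<size (≤-trans (size≤4·[2+k]² k) (*-monoʳ-≤ (2 * 2) (*-mono-≤ 2+k≤α 2+k≤α)))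

corollary30 :
    -- family 𝓕 = { G k | k : ℕ }, with n k vertices, sizes unbounded (so infinite),
    -- constant c = cn / cd > 0, budget β k with d₁ √(n k) ≤ β k ≤ d₂ √(n k)
    Σ (ℕ → ℕ) λ n → Σ ((k : ℕ) → Graph (n k)) λ G → Σ (ℕ → ℕ) λ β →
    Σ ℕ λ cn → Σ ℕ λ cd → Σ ℕ λ d₁n → Σ ℕ λ d₁d → Σ ℕ λ d₂n → Σ ℕ λ d₂d →
      (0 < cn × 0 < cd × 0 < d₁n × 0 < d₁d × 0 < d₂n × 0 < d₂d)
      × (∀ m → ∃ λ k → m ≤ n k)
      × (∀ k → Connected (G k))
      × (∀ k → d₁n * d₁n * n k ≤ d₁d * d₁d * (β k * β k)
             × d₂d * d₂d * (β k * β k) ≤ d₂n * d₂n * n k)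
      × (∀ k (α : ℕ) → cd * cd * (α * α) < cn * cn * n k →
           ∀ (a : ℕ) → a ≤ α → (H : Graph (n k + a)) →
           IsAugmentation (G k) a (β k) H →
           ¬ UniversallySolvable H (n k))
corollary30 =
  size , family , budget , 1 , 2 , 1 , 4 , 1 , 1 ,
  (s≤s z≤n , s≤s z≤n , s≤s z≤n , s≤s z≤n , s≤s z≤n , s≤s z≤n) ,
  (λ k → k , k≤size k) ,
  (λ k → Spider.spider-connected (legs k) (2 + k)) ,
  (λ k → size≤16·budget² k , budget²≤size k) ,
  λ k α 4α²<size a a≤α H →
    augmented-spider-unsolvable H (s≤s (≤-trans a≤α (4α²<size⇒α≤1+k k α 4α²<size))) (2·budget<legs k)
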